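{- The graph $G$ (defined in the context) is a connected 12-regular graph of order 42 and diameter 3 which is a $\{K_4\}_{42}^4\{K_{2,2,2}\}_{21}^3$-graph. Each vertex of $G$ is incident to exactly 3 copies of $K_{2,2,2}$ and exactly 4 copies of $K_4$.
   Context: The Fano plane $\mathcal F$ has points $1,\dots,7$ and lines $\{1,2,3\},\{1,4,5\},\{1,6,7\},\{2,4,6\},\{2,5,7\},\{3,4,7\},\{3,5,6\}$. For a point $p$, the three lines through $p$ are $\{p,q,r\}$ for three disjoint pairs $\{q,r\}$ partitioning $\mathcal F\setminus\{p\}$. An ordered pencil through $p$ is a tuple $v=(p,q_ar_a,q_br_b,q_cr_c)$ in which $q_ar_a,q_br_b,q_cr_c$ are these three (unordered) pairs listed in a chosen linear order (positions $a<b<c$); there are 6 ordered pencils through each point, 42 in total. The graph $G$ has the 42 ordered pencils as vertices, with $v=(p,q_ar_a,q_br_b,q_cr_c)$ and $v'=(p',q'_ar'_a,q'_br'_b,q'_cr'_c)$ adjacent iff $p\neq p'$ and $|\{q_i,r_i\}\cap\{q'_i,r'_i\}|=1$ for each $i\in\{a,b,c\}$. A "copy of $H$" in $G$ means an induced subgraph of $G$ isomorphic to $H$. For a connected regular graph $H$ and integers $1<m<n$, an $\{H\}_n^m$-graph is a connected graph that (a) is an edge-disjoint union of $n$ induced copies of $H$; (b) has exactly $m$ copies of $H$ containing each vertex, no two of which share more than one vertex; (c) has exactly $n$ induced subgraphs isomorphic to $H$. A graph is an $\{H_1\}_{n_1}^{m_1}\{H_2\}_{n_2}^{m_2}$-graph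 ($H_1\neq H_2$) if it is both an $\{H_1\}_{n_1}^{m_1}$-graph and an $\{H_2\}_{n_2}^{m_2}$-graph. $K_{2,2,2}$ is the octahedron graph. -}

module Defs where

open import Data.Nat using (ℕ; zero; suc; _+_; _≤_; _<_)
open import Data.Fin using (Fin; #_; toℕ)
open import Data.Fin.Properties using () renaming (_≟_ to _≟F_)
open import Data.Bool using (Bool; true; false; _∧_; _∨_; not; T; if_then_else_)
open import Data.Product using (Σ; ∃; ∃-syntax; _×_; _,_)
open import Data.Unit using (⊤)
open import Data.List using (List; []; _∷_; length)
open import Data.Bool.ListAction using (any)
open import Data.List.Relation.Unary.All using (All)
open import Data.List.Relation.Unary.Unique.Propositional using (Unique)
open import Data.List.Membership.Propositional using (_∈_)
open import Relation.Binary.PropositionalEquality using (_≡_; _≢_)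
open import Relation.Nullary using (¬_; does)

record Graph : Set₁ where
  field
    V   : Set
    Adj : V → V → Set
open Graph public

HasCard : {A : Set} → (A → Set) → ℕ → Set
HasCard {A} P n =
  Σ (List A) λ xs → Unique xs × All P xs × (∀ x → P x → x ∈ xs) × length xs ≡ n

HasOrder : Graph → ℕ → Set
HasOrder G n = HasCard {V G} (λ _ → ⊤) n

IsRegular : Graph → ℕ → Set
IsRegular G k = ∀ (v : V G) → HasCard (Adj G v) k

data Walk (G : Graph) : V G → V G → ℕ → Set where
  nil  : ∀ {u} → Walk G u u 0
  cons : ∀ {u v w n} → Adj G u v → Walk G v w n → Walk G u w (suc n)

Connected : Graph → Set
Connected G = ∀ (u v : V G) → ∃[ n ] Walk G u v n

HasDiameter : Graph → ℕ → Set
HasDiameter G d =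
  (∀ (u v : V G) → ∃[ n ] (n ≤ d × Walk G u v n)) ×
  (∃[ u ] ∃[ v ] (∀ n → Walk G u v n → d ≤ n))

record InducedEmb (H G : Graph) : Set where
  field
    f    : V H → V G
    inj  : ∀ i j → f i ≡ f j → i ≡ j
    pres : ∀ i j → Adj H i j → Adj G (f i) (f j)
    refl : ∀ i j → Adj G (f i) (f j) → Adj H i j
open InducedEmb public

_∈C_ : {H G : Graph} → V G → InducedEmb H G → Set
v ∈C e = ∃ λ i → f e i ≡ v

SameCopy : {H G : Graph} → InducedEmb H G → InducedEmb H G → Set
SameCopy {H} {G} e e' = ∀ (v : V G) → (v ∈C e → v ∈C e') × (v ∈C e' → v ∈C e)

ListsAllCopies : (G H : Graph) (n : ℕ) → (Fin n → InducedEmb H G) → Set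
ListsAllCopies G H n c =
  (∀ i j → SameCopy (c i) (c j) → i ≡ j) ×
  (∀ (e : InducedEmb H G) → ∃ λ i → SameCopy e (c i))

CopiesContaining : (G H : Graph) → V G → ℕ → Set
CopiesContaining G H v m =
  Σ (Fin m → InducedEmb H G) λ d →
    (∀ i → v ∈C d i) ×
    (∀ i j → SameCopy (d i) (d j) → i ≡ j) ×
    (∀ (e : InducedEmb H G) → v ∈C e → ∃ λ i → SameCopy e (d i))

IsHGraph : (G H : Graph) (n m : ℕ) → Set
IsHGraph G H n m =
  1 < m × m < n ×
  Connected G ×
  -- (a) G is an edge-disjoint union of n induced copies of H
  (Σ (Fin n → InducedEmb H G) λ c →
     (∀ u v → Adj G u v → ∃ λ i → u ∈C c i × v ∈C c i) ×
     (∀ u v i j → Adj G u v → u ∈C c i → v ∈C c i → u ∈C c j → v ∈C c j → i ≡ j)) ×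
  -- (c) G has exactly n induced copies of H, and
  -- (b) each vertex lies in exactly m of them, two of which share at most one vertex
  (Σ (Fin n → InducedEmb H G) λ c →
     ListsAllCopies G H n c ×
     (∀ v → HasCard (λ i → v ∈C c i) m) ×
     (∀ i j → i ≢ j → ∀ u v → u ∈C c i → v ∈C c i → u ∈C c j → v ∈C c j → u ≡ v))

K4 : Graph
K4 = record { V = Fin 4 ; Adj = λ i j → i ≢ j }

K222 : Graph
K222 = record { V = Fin 3 × Fin 2 ; Adj = λ { (a , _) (b , _) → a ≢ b } }

-- The Fano plane (paper's point k is Fin element k-1)

Point : Set
Point = Fin 7

Triple : Set
Triple = Point × Point × Point

fanoLines : List Triple
fanoLines =
  (# 0 , # 1 , # 2) ∷ (# 0 , # 3 , # 4) ∷ (# 0 , # 5 , # 6) ∷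
  (# 1 , # 3 , # 5) ∷ (# 1 , # 4 , # 6) ∷ (# 2 , # 3 , # 6) ∷
  (# 2 , # 4 , # 5) ∷ []

eqᵇ : Point → Point → Bool
eqᵇ x y = does (x ≟F y)

inTripleᵇ : Point → Triple → Bool
inTripleᵇ w (a , b , c) = eqᵇ w a ∨ eqᵇ w b ∨ eqᵇ w c

isLineᵇ : Point → Point → Point → Bool
isLineᵇ x y z =
  not (eqᵇ x y) ∧ not (eqᵇ x z) ∧ not (eqᵇ y z) ∧
  any (λ l → inTripleᵇ x l ∧ inTripleᵇ y l ∧ inTripleᵇ z l) fanoLines

-- an unordered pair {q,r} is represented by (q , r) with q < r
Pair : Set
Pair = Point × Point

ltᵇ : Point → Point → Bool
ltᵇ x y = does (Data.Nat._<?_ (toℕ x) (toℕ y))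
  where import Data.Nat

samePairᵇ : Pair → Pair → Bool
samePairᵇ (q , r) (q' , r') = eqᵇ q q' ∧ eqᵇ r r'

pencilPairᵇ : Point → Pair → Bool
pencilPairᵇ p (q , r) = ltᵇ q r ∧ isLineᵇ p q r

-- data of an ordered pencil (p, q_a r_a, q_b r_b, q_c r_c)
PencilData : Set
PencilData = Point × Pair × Pair × Pair

isOrdPencilᵇ : PencilData → Bool
isOrdPencilᵇ (p , A , B , C) =
  pencilPairᵇ p A ∧ pencilPairᵇ p B ∧ pencilPairᵇ p C ∧
  not (samePairᵇ A B) ∧ not (samePairᵇ A C) ∧ not (samePairᵇ B C)

OrdPencil : Set
OrdPencil = Σ PencilData (λ d → T (isOrdPencilᵇ d))

interSize : Pair → Pair → ℕ
interSize (q , r) (q' , r') =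
  (if eqᵇ q q' ∨ eqᵇ q r' then 1 else 0) + (if eqᵇ r q' ∨ eqᵇ r r' then 1 else 0)

AdjG : OrdPencil → OrdPencil → Set
AdjG ((p , A , B , C) , _) ((p' , A' , B' , C') , _) =
  p ≢ p' × interSize A A' ≡ 1 × interSize B B' ≡ 1 × interSize C C' ≡ 1

G : Graph
G = record { V = OrdPencil ; Adj = AdjG }

module Submission where

-- The graph G of ordered pencils of the Fano plane is a finite object, so
-- every clause of the theorem is a finite check.

open import Defs hiding (refl)
open import Data.Bool using (Bool; true; false; T; not; _∧_; _∨_; if_then_else_)
open import Data.Bool.ListAction using (all)
open import Data.Bool.Properties using (T?; T-irrelevant; T-∧; T-∨)
open import Data.Empty using (⊥-elim)
open import Data.Fin using (Fin; zero; suc)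
import Data.Fin.Properties as Fin
open import Data.List
  using ( List; []; _∷_; [_]; _++_; map; concatMap; filter; length; lookup; allFin; iterate; zip
        ; cartesianProduct)
open import Data.List.Membership.Propositional using (_∈_; find)
open import Data.List.Membership.Propositional.Properties
  using ( ∈-map⁺; ∈-map⁻; ∈-++⁺ˡ; ∈-++⁺ʳ; ∈-++⁻; ∈-concatMap⁺; ∈-filter⁺; ∈-filter⁻; ∈-allFin; ∈-lookup
        ; ∈-cartesianProduct⁺)
import Data.List.Membership.DecPropositional as DecMembership
open import Data.List.Relation.Unary.All as All using (All; []; _∷_; all?)
import Data.List.Relation.Unary.All.Properties as All
open import Data.List.Relation.Unary.Any as Any using (Any; here; there; any?)
open import Data.List.Relation.Unary.Any.Properties using (lookup-index)
open import Data.List.Relation.Unary.AllPairs using (allPairs?; []; _∷_)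
open import Data.List.Relation.Unary.Unique.Propositional using (Unique)
import Data.List.Relation.Unary.Unique.Propositional.Properties as Unique
open import Data.Nat using (ℕ; zero; suc; _+_; _*_; _/_; _%_; _≡ᵇ_; _≤_; _<_; _≤?_; z≤n; s≤s)
open import Data.Nat.DivMod using (_mod_)
import Data.Nat.Properties as ℕ
open import Data.Product using (Σ; ∃; _×_; _,_; proj₁; proj₂)
open import Data.Product.Properties using (≡-dec)
open import Data.Sum using (_⊎_; inj₁; inj₂; [_,_]′)
open import Data.Unit using (tt)
open import Data.Vec using (Vec; []; _∷_) renaming (lookup to lookupᵛ)
open import Function using (_∘_; Equivalence)
open import Relation.Binary.Definitions using (DecidableEquality; Decidable)
open import Relation.Binary.PropositionalEquality
  using (_≡_; _≢_; refl; sym; trans; cong; subst; subst₂)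
open import Relation.Nullary using (¬_; Dec; yes; no; does; ¬?; _×-dec_; _⊎-dec_; _→-dec_)
open import Relation.Nullary.Decidable using (from-yes; map′)
import Relation.Unary as U

module _ {A : Set} where

  lookup-injective : ∀ {xs : List A} → Unique xs → ∀ i j → lookup xs i ≡ lookup xs j → i ≡ j
  lookup-injective (_ ∷ _) zero zero _ = refl
  lookup-injective (x∉ ∷ _) zero (suc j) x≡ = ⊥-elim (All.lookup x∉ (∈-lookup j) x≡)
  lookup-injective (x∉ ∷ _) (suc i) zero x≡ = ⊥-elim (All.lookup x∉ (∈-lookup i) (sym x≡))
  lookup-injective (_ ∷ u) (suc i) (suc j) x≡ = cong suc (lookup-injective u i j x≡)

  enumerate : ∀ {P : A → Set} {m} → HasCard P m →
    Σ (Fin m → A) λ g →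
      (∀ i → P (g i)) × (∀ i j → g i ≡ g j → i ≡ j) × (∀ x → P x → ∃ λ i → g i ≡ x)
  enumerate (xs , unique , Pxs , complete , refl) =
    lookup xs ,
    (λ i → All.lookup Pxs (∈-lookup i)) ,
    lookup-injective unique ,
    λ x Px → let x∈xs = complete x Px in Any.index x∈xs , sym (lookup-index x∈xs)

  filter-card : ∀ {P : A → Set} (P? : U.Decidable P) (xs : List A) →
    (∀ x → x ∈ xs) → Unique xs → HasCard P (length (filter P? xs))
  filter-card P? xs complete unique =
    filter P? xs , Unique.filter⁺ P? unique , All.all-filter P? xs ,
    (λ x Px → ∈-filter⁺ P? (complete x) Px) , refl

  card-resp-⇔ : ∀ {P Q : A → Set} {m} →
    (∀ {x} → P x → Q x) → (∀ {x} → Q x → P x) → HasCard P m → HasCard Q m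
  card-resp-⇔ P⇒Q Q⇒P (xs , unique , Pxs , complete , len) =
    xs , unique , All.map P⇒Q Pxs , (λ x → complete x ∘ Q⇒P) , len

  length≤1⇒equal : ∀ {xs : List A} {x y} → length xs ≤ 1 → x ∈ xs → y ∈ xs → x ≡ y
  length≤1⇒equal {_ ∷ []} _ (here refl) (here refl) = refl
  length≤1⇒equal {_ ∷ _ ∷ _} (s≤s ()) _ _

  unique-map⇒injective : ∀ {B : Set} {f : A → B} {xs} → Unique (map f xs) →
    ∀ {x y} → x ∈ xs → y ∈ xs → f x ≡ f y → x ≡ y
  unique-map⇒injective _ (here refl) (here refl) _ = refl
  unique-map⇒injective {f = f} (fx∉ ∷ _) (here refl) (there y∈) fx≡fy =
    ⊥-elim (All.lookup fx∉ (∈-map⁺ f y∈) fx≡fy)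
  unique-map⇒injective {f = f} (fy∉ ∷ _) (there x∈) (here refl) fx≡fy =
    ⊥-elim (All.lookup fy∉ (∈-map⁺ f x∈) (sym fx≡fy))
  unique-map⇒injective (_ ∷ unique) (there x∈) (there y∈) fx≡fy =
    unique-map⇒injective unique x∈ y∈ fx≡fy

∈-concatMap : ∀ {A B : Set} (g : A → List B) {xs x y} → x ∈ xs → y ∈ g x → y ∈ concatMap g xs
∈-concatMap g x∈ y∈ = ∈-concatMap⁺ g (Any.map (λ { refl → y∈ }) x∈)

-- Membership of a number in a list, decided by a Boolean scan (much faster
-- to evaluate than the generic decision procedure).
elemᵇ : ℕ → List ℕ → Bool
elemᵇ x [] = false
elemᵇ x (y ∷ ys) = (x ≡ᵇ y) ∨ elemᵇ x ys

elemᵇ-sound : ∀ x ys → T (elemᵇ x ys) → x ∈ ys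
elemᵇ-sound x (y ∷ ys) t =
  [ (λ x≡ᵇy → here (ℕ.≡ᵇ⇒≡ x y x≡ᵇy)) , (λ t' → there (elemᵇ-sound x ys t')) ]′
    (Equivalence.to (T-∨ {x ≡ᵇ y}) t)

elemᵇ-complete : ∀ {x ys} → x ∈ ys → T (elemᵇ x ys)
elemᵇ-complete {x} (here refl) = Equivalence.from T-∨ (inj₁ (ℕ.≡⇒≡ᵇ x x refl))
elemᵇ-complete {x} {y ∷ _} (there x∈) = Equivalence.from (T-∨ {x ≡ᵇ y}) (inj₂ (elemᵇ-complete x∈))

infix 4 _∈?_
_∈?_ : (x : ℕ) (ys : List ℕ) → Dec (x ∈ ys)
x ∈? ys = map′ (elemᵇ-sound x ys) elemᵇ-complete (T? (elemᵇ x ys))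

not-T : ∀ {b} → ¬ T b → T (not b)
not-T {true} ¬b = ¬b tt
not-T {false} _ = tt

module Walks (G : Graph) where

  _++ʷ_ : ∀ {u v w m n} → Walk G u v m → Walk G v w n → Walk G u w (m + n)
  nil ++ʷ q = q
  cons a p ++ʷ q = cons a (p ++ʷ q)

  Within : ℕ → V G → V G → Set
  Within k u v = ∃ λ n → n ≤ k × Walk G u v n

  within-refl : ∀ {k u} → Within k u u
  within-refl = 0 , z≤n , nil

  within-adj : ∀ {u v} → Adj G u v → Within 1 u v
  within-adj a = 1 , s≤s z≤n , cons a nil

  within-trans : ∀ {a b u v w} → Within a u v → Within b v w → Within (a + b) u w
  within-trans (m , m≤a , p) (n , n≤b , q) = m + n , ℕ.+-mono-≤ m≤a n≤b , p ++ʷ q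

  within-connected : ∀ {k} → (∀ u v → Within k u v) → Connected G
  within-connected within u v = let (n , _ , p) = within u v in n , p

  short-walk : ∀ {u v n} → n < 3 → Walk G u v n →
    u ≡ v ⊎ Adj G u v ⊎ ∃ λ w → Adj G u w × Adj G w v
  short-walk _ nil = inj₁ refl
  short-walk _ (cons a nil) = inj₂ (inj₁ a)
  short-walk _ (cons a (cons b nil)) = inj₂ (inj₂ (_ , a , b))
  short-walk (s≤s (s≤s (s≤s ()))) (cons _ (cons _ (cons _ _)))

  distance≥3 : ∀ {u v} → u ≢ v → ¬ Adj G u v → (∀ w → ¬ (Adj G u w × Adj G w v)) →
    ∀ n → Walk G u v n → 3 ≤ n
  distance≥3 u≢v ¬uv no-path n p with 3 ≤? n
  ... | yes 3≤n = 3≤n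
  ... | no 3≰n with short-walk (ℕ.≰⇒> 3≰n) p
  ...   | inj₁ u≡v = ⊥-elim (u≢v u≡v)
  ...   | inj₂ (inj₁ uv) = ⊥-elim (¬uv uv)
  ...   | inj₂ (inj₂ (w , uw , wv)) = ⊥-elim (no-path w (uw , wv))

module FiniteGraph (G : Graph) (vertices : List (V G)) (complete : ∀ v → v ∈ vertices)
  (unique : Unique vertices) (_≟_ : DecidableEquality (V G)) (adj? : Decidable (Adj G)) where

  open Walks G

  order : HasOrder G (length vertices)
  order = vertices , unique , All.tabulate (λ _ → tt) , (λ v _ → complete v) , refl

  neighbours : V G → List (V G)
  neighbours v = filter (adj? v) vertices

  regular : ∀ {k} → All (λ v → length (neighbours v) ≡ k) vertices → IsRegular G k
  regular degrees v =
    subst (HasCard (Adj G v)) (All.lookup degrees (complete v))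
      (filter-card (adj? v) vertices complete unique)

  ball coball : V G → List (V G)
  ball u = u ∷ neighbours u
  coball v = v ∷ filter (λ w → adj? w v) vertices

  Near : V G → V G → Set
  Near u v = Any (λ w → Any (λ w' → w ≡ w' ⊎ Adj G w w') (coball v)) (ball u)

  near? : Decidable Near
  near? u v = any? (λ w → any? (λ w' → w ≟ w' ⊎-dec adj? w w') (coball v)) (ball u)

  ball-within : ∀ {u w} → w ∈ ball u → Within 1 u w
  ball-within (here refl) = within-refl
  ball-within {u} (there w∈) = within-adj (proj₂ (∈-filter⁻ (adj? u) {xs = vertices} w∈))

  coball-within : ∀ {v w} → w ∈ coball v → Within 1 w v
  coball-within (here refl) = within-refl
  coball-within {v} (there w∈) = within-adj (proj₂ (∈-filter⁻ (λ w → adj? w v) {xs = vertices} w∈))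

  step-within : ∀ {w w'} → w ≡ w' ⊎ Adj G w w' → Within 1 w w'
  step-within (inj₁ refl) = within-refl
  step-within (inj₂ ww') = within-adj ww'

  near-within : ∀ {u v} → Near u v → Within 3 u v
  near-within near =
    let (w , w∈ , near') = find near
        (w' , w'∈ , step) = find near'
    in within-trans (within-trans (ball-within w∈) (step-within step)) (coball-within w'∈)

  AllNear : Set
  AllNear = All (λ u → All (Near u) vertices) vertices

  within3 : AllNear → ∀ u v → Within 3 u v
  within3 near u v = near-within (All.lookup (All.lookup near (complete u)) (complete v))

  connected : AllNear → Connected G
  connected near = within-connected (within3 near)

  diameter : ∀ {u₀ v₀} → AllNear →
    u₀ ≢ v₀ → ¬ Adj G u₀ v₀ → All (λ w → ¬ (Adj G u₀ w × Adj G w v₀)) vertices →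
    HasDiameter G 3
  diameter near u₀≢v₀ ¬u₀v₀ no-path =
    within3 near , _ , _ , distance≥3 u₀≢v₀ ¬u₀v₀ (λ w → All.lookup no-path (complete w))

module Copies {G H : Graph} {n : ℕ} (copy : Fin n → InducedEmb H G) where

  CoversEdges : Set
  CoversEdges = ∀ u v → Adj G u v → ∃ λ i → u ∈C copy i × v ∈C copy i

  MeetInAtMostOneVertex : Set
  MeetInAtMostOneVertex =
    ∀ i j → i ≢ j → ∀ u v → u ∈C copy i → v ∈C copy i → u ∈C copy j → v ∈C copy j → u ≡ v

  Exhaustive : Set
  Exhaustive = ∀ (e : InducedEmb H G) → ∃ λ i → SameCopy e (copy i)

  -- As H has two vertices, copies meeting in at most one vertex are different.
  distinct : MeetInAtMostOneVertex → ∀ {h₀ h₁} → h₀ ≢ h₁ →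
    ∀ i j → SameCopy (copy i) (copy j) → i ≡ j
  distinct meet {h₀} {h₁} h₀≢h₁ i j same with i Fin.≟ j
  ... | yes i≡j = i≡j
  ... | no i≢j = ⊥-elim (h₀≢h₁ (inj (copy i) h₀ h₁
          (meet i j i≢j _ _ (h₀ , refl) (h₁ , refl)
            (proj₁ (same _) (h₀ , refl)) (proj₁ (same _) (h₁ , refl)))))

  edge-disjoint : MeetInAtMostOneVertex → (∀ u → ¬ Adj G u u) →
    ∀ u v i j → Adj G u v → u ∈C copy i → v ∈C copy i → u ∈C copy j → v ∈C copy j → i ≡ j
  edge-disjoint meet loopless u v i j uv ui vi uj vj with i Fin.≟ j
  ... | yes i≡j = i≡j
  ... | no i≢j = ⊥-elim (loopless v (subst (λ w → Adj G w v) (meet i j i≢j u v ui vi uj vj) uv))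

  containing : Exhaustive → (∀ i j → SameCopy (copy i) (copy j) → i ≡ j) →
    ∀ {v m} → HasCard (λ i → v ∈C copy i) m → CopiesContaining G H v m
  containing exhaustive different {v} through-v with enumerate through-v
  ... | g , g-through , g-injective , g-onto =
    copy ∘ g , g-through ,
    (λ a b same → g-injective a b (different (g a) (g b) same)) ,
    λ e v∈e → let (i , same) = exhaustive e
                  (a , ga≡i) = g-onto i (proj₁ (same v) v∈e)
              in a , subst (λ k → SameCopy e (copy k)) (sym ga≡i) same

  isHGraph : ∀ {m} → 1 < m → m < n → Connected G → (∀ u → ¬ Adj G u u) →
    ∀ {h₀ h₁} → h₀ ≢ h₁ → CoversEdges → MeetInAtMostOneVertex → Exhaustive →
    (∀ v → HasCard (λ i → v ∈C copy i) m) → IsHGraph G H n m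
  isHGraph 1<m m<n connected loopless h₀≢h₁ covers meet exhaustive through =
    1<m , m<n , connected ,
    (copy , covers , edge-disjoint meet loopless) ,
    (copy , (distinct meet h₀≢h₁ , exhaustive) , through , meet)

-- Vertex number i is coded by 2^i and a set of vertices by the sum of their
-- codes, so that membership of a code in a set is a single division.  Only
-- the agreement of these bitmasks with adjacency, checked for the concrete
-- coding, is ever used.
_∈ᵇ_ : ℕ → ℕ → Bool
zero ∈ᵇ s = false
x@(suc _) ∈ᵇ s = s / x % 2 ≡ᵇ 1

module Coding (G : Graph) (vertexAt : ℕ → V G) (codes : List ℕ) (mask : ℕ → ℕ)
  (decoding-onto : ∀ v → v ∈ map vertexAt codes)
  (decoding-injective : ∀ {x y} → x ∈ codes → y ∈ codes → vertexAt x ≡ vertexAt y → x ≡ y)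
  (mask-sound : ∀ {x y} → x ∈ codes → y ∈ codes → T (y ∈ᵇ mask x) → Adj G (vertexAt x) (vertexAt y))
  (mask-complete : ∀ {x y} → x ∈ codes → y ∈ codes → Adj G (vertexAt x) (vertexAt y) → T (y ∈ᵇ mask x))
  where

  codeOf : V G → ℕ
  codeOf v = proj₁ (∈-map⁻ vertexAt (decoding-onto v))

  codeOf-valid : ∀ v → codeOf v ∈ codes
  codeOf-valid v = proj₁ (proj₂ (∈-map⁻ vertexAt (decoding-onto v)))

  decode-codeOf : ∀ v → vertexAt (codeOf v) ≡ v
  decode-codeOf v = sym (proj₂ (proj₂ (∈-map⁻ vertexAt (decoding-onto v))))

  codeOf-decode : ∀ {x} → x ∈ codes → codeOf (vertexAt x) ≡ x
  codeOf-decode x∈ = decoding-injective (codeOf-valid _) x∈ (decode-codeOf _)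

  codeOf-injective : ∀ {u v} → codeOf u ≡ codeOf v → u ≡ v
  codeOf-injective {u} {v} same =
    trans (sym (decode-codeOf u)) (trans (cong vertexAt same) (decode-codeOf v))

  adj⇒mask : ∀ {u v} → Adj G u v → T (codeOf v ∈ᵇ mask (codeOf u))
  adj⇒mask {u} {v} uv = mask-complete (codeOf-valid u) (codeOf-valid v)
    (subst₂ (Adj G) (sym (decode-codeOf u)) (sym (decode-codeOf v)) uv)

  mask⇒adj : ∀ {u v} → T (codeOf v ∈ᵇ mask (codeOf u)) → Adj G u v
  mask⇒adj {u} {v} t =
    subst₂ (Adj G) (decode-codeOf u) (decode-codeOf v) (mask-sound (codeOf-valid u) (codeOf-valid v) t)

  module Pattern (H : Graph) (h₀ : V H) (ks : List (V H))
    (hs-complete : ∀ h → h ∈ h₀ ∷ ks) (hs-unique : Unique (h₀ ∷ ks))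
    (_≟ᴴ_ : DecidableEquality (V H)) (adjᴴ? : Decidable (Adj H)) where

    hs : List (V H)
    hs = h₀ ∷ ks

    -- A partial assignment lists entries (h , x , mask x): pattern vertex h is
    -- sent to the vertex with code x, whose neighbourhood mask is cached.
    Entry : Set
    Entry = V H × ℕ × ℕ

    entry : V H → ℕ → Entry
    entry h x = h , x , mask x

    entryCode : Entry → ℕ
    entryCode (_ , x , _) = x

    -- Sending h to x is consistent with an earlier entry: adjacency in H
    -- forces adjacency in G, and non-adjacency forces a different,
    -- non-adjacent vertex.
    fits : V H → ℕ → Entry → Bool
    fits h x (h' , y , s) = if does (adjᴴ? h' h) then x ∈ᵇ s else not (x ∈ᵇ s) ∧ not (x ≡ᵇ y)

    extensions : V H → List Entry → List ℕ
    extensions h as = filter (λ x → T? (all (fits h x) as)) codes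

    grow : V H → List Entry → List (List Entry)
    grow h as = map (λ x → entry h x ∷ as) (extensions h as)

    -- Backtracking search: the consistent extensions of the assignment as to
    -- the pattern vertices ls, assigned from the last one to the first.
    search : List (V H) → List Entry → List (List Entry)
    search [] as = [ as ]
    search (h ∷ ls) as = concatMap (grow h) (search ls as)

    searchAt : ℕ → List (List Entry)
    searchAt x = search ks [ entry h₀ x ]

    trace : InducedEmb H G → List (V H) → List Entry
    trace e ls = map (λ h → entry h (codeOf (f e h))) ls

    trace-fits : (e : InducedEmb H G) {h h' : V H} → h ≢ h' →
      T (fits h (codeOf (f e h)) (entry h' (codeOf (f e h'))))
    trace-fits e {h} {h'} h≢h' with adjᴴ? h' h
    ... | yes h'h = adj⇒mask (pres e h' h h'h)
    ... | no ¬h'h = Equivalence.from T-∧ (not-T non-adjacent , not-T different)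
      where
      non-adjacent : ¬ T (codeOf (f e h) ∈ᵇ mask (codeOf (f e h')))
      non-adjacent t = ¬h'h (InducedEmb.refl e h' h (mask⇒adj t))
      different : ¬ T (codeOf (f e h) ≡ᵇ codeOf (f e h'))
      different t = h≢h' (inj e h h' (codeOf-injective (ℕ.≡ᵇ⇒≡ _ _ t)))

    search-complete : (e : InducedEmb H G) → ∀ {ls as} → Unique ls →
      All (λ h → All (T ∘ fits h (codeOf (f e h))) as) ls → trace e ls ++ as ∈ search ls as
    search-complete e {[]} _ _ = here refl
    search-complete e {h ∷ ls} {as} (h∉ls ∷ unique) (h-fits ∷ ls-fit) =
      ∈-concatMap (grow h) (search-complete e unique ls-fit)
        (∈-map⁺ (λ x → entry h x ∷ (trace e ls ++ as)) extends)
      where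
      extends : codeOf (f e h) ∈ extensions h (trace e ls ++ as)
      extends = ∈-filter⁺ (λ x → T? (all (fits h x) (trace e ls ++ as))) (codeOf-valid (f e h))
        (All.all⁻ (fits h (codeOf (f e h))) (All.++⁺ (All.map⁺ (All.map (trace-fits e) h∉ls)) h-fits))

    traced : InducedEmb H G → List Entry
    traced e = trace e ks ++ trace e [ h₀ ]

    traced-found : (e : InducedEmb H G) → traced e ∈ searchAt (codeOf (f e h₀))
    traced-found e = found hs-unique
      where
      found : Unique (h₀ ∷ ks) → traced e ∈ searchAt (codeOf (f e h₀))
      found (h₀∉ks ∷ ks-unique) =
        search-complete e ks-unique (All.map (λ h₀≢h → trace-fits e (h₀≢h ∘ sym) ∷ []) h₀∉ks)

    traced-codes⁺ : ∀ e h → codeOf (f e h) ∈ map entryCode (traced e)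
    traced-codes⁺ e h with hs-complete h
    ... | here refl = ∈-map⁺ entryCode (∈-++⁺ʳ (trace e ks) (here refl))
    ... | there h∈ks = ∈-map⁺ entryCode (∈-++⁺ˡ (∈-map⁺ (λ h → entry h (codeOf (f e h))) h∈ks))

    traced-codes⁻ : ∀ e {x} → x ∈ map entryCode (traced e) → ∃ λ h → x ≡ codeOf (f e h)
    traced-codes⁻ e x∈ =
      let (a , a∈ , x≡) = ∈-map⁻ entryCode x∈
          (h , a≡) = [ traced-entry , traced-entry ]′ (∈-++⁻ (trace e ks) a∈)
      in h , trans x≡ (cong entryCode a≡)
      where
      traced-entry : ∀ {ls a} → a ∈ trace e ls → ∃ λ h → a ≡ entry h (codeOf (f e h))
      traced-entry a∈ = let (h , _ , a≡) = ∈-map⁻ (λ h → entry h (codeOf (f e h))) a∈ in h , a≡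

    CodePair : (V H → ℕ) → V H → V H → Set
    CodePair g a b =
      (g a ≡ g b → a ≡ b) × (Adj H a b → T (g b ∈ᵇ mask (g a))) × (T (g b ∈ᵇ mask (g a)) → Adj H a b)

    IsCopyCode : (V H → ℕ) → Set
    IsCopyCode g = All (λ a → g a ∈ codes × All (CodePair g a) hs) hs

    isCopyCode? : ∀ g → Dec (IsCopyCode g)
    isCopyCode? g = all? (λ a → g a ∈? codes ×-dec all? (λ b →
      (g a ℕ.≟ g b →-dec a ≟ᴴ b) ×-dec
      (adjᴴ? a b →-dec T? (g b ∈ᵇ mask (g a))) ×-dec (T? (g b ∈ᵇ mask (g a)) →-dec adjᴴ? a b)) hs) hs

    copyEmbedding : (g : V H → ℕ) → IsCopyCode g → InducedEmb H G
    copyEmbedding g valid = record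
      { f = vertexAt ∘ g
      ; inj = λ a b e → proj₁ (pair a b) (decoding-injective (code a) (code b) e)
      ; pres = λ a b ab → mask-sound (code a) (code b) (proj₁ (proj₂ (pair a b)) ab)
      ; refl = λ a b ab → proj₂ (proj₂ (pair a b)) (mask-complete (code a) (code b) ab)
      }
      where
      code : ∀ a → g a ∈ codes
      code a = proj₁ (All.lookup valid (hs-complete a))
      pair : ∀ a b → CodePair g a b
      pair a b = All.lookup (proj₂ (All.lookup valid (hs-complete a))) (hs-complete b)

    module Table {n} (table : Fin n → V H → ℕ) (valid : ∀ i → IsCopyCode (table i)) where

      copy : Fin n → InducedEmb H G
      copy i = copyEmbedding (table i) (valid i)

      open Copies copy public

      row : Fin n → List ℕ
      row i = map (table i) hs

      ∈C⇒row : ∀ {v i} → v ∈C copy i → codeOf v ∈ row i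
      ∈C⇒row {i = i} (h , refl) =
        subst (_∈ row i) (sym (codeOf-decode (proj₁ (All.lookup (valid i) (hs-complete h)))))
          (∈-map⁺ (table i) (hs-complete h))

      row⇒∈C : ∀ {v i} → codeOf v ∈ row i → v ∈C copy i
      row⇒∈C {v} {i} v∈ = let (h , _ , codeOf-v≡) = ∈-map⁻ (table i) v∈ in
        h , trans (cong vertexAt (sym codeOf-v≡)) (decode-codeOf v)

      RowsCoverEdges : Set
      RowsCoverEdges = All (λ x → All (λ y →
        T (y ∈ᵇ mask x) → Any (λ i → x ∈ row i × y ∈ row i) (allFin n)) codes) codes

      rowsCoverEdges? : Dec RowsCoverEdges
      rowsCoverEdges? = all? (λ x → all? (λ y →
        T? (y ∈ᵇ mask x) →-dec any? (λ i → x ∈? row i ×-dec y ∈? row i) (allFin n)) codes) codes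

      RowsMeetInAtMostOne : Set
      RowsMeetInAtMostOne = All (λ i → All (λ j →
        i ≡ j ⊎ length (filter (_∈? row j) (row i)) ≤ 1) (allFin n)) (allFin n)

      rowsMeetInAtMostOne? : Dec RowsMeetInAtMostOne
      rowsMeetInAtMostOne? = all? (λ i → all? (λ j →
        i Fin.≟ j ⊎-dec length (filter (_∈? row j) (row i)) ≤? 1) (allFin n)) (allFin n)

      rowsThrough : ℕ → List (Fin n)
      rowsThrough x = filter (λ i → x ∈? row i) (allFin n)

      RowCount : ℕ → Set
      RowCount m = All (λ x → length (rowsThrough x) ≡ m) codes

      rowCount? : ∀ m → Dec (RowCount m)
      rowCount? m = all? (λ x → length (rowsThrough x) ℕ.≟ m) codes

      SameCodes : List ℕ → List ℕ → Set
      SameCodes xs ys = All (_∈ ys) xs × All (_∈ xs) ys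

      SearchListed : Set
      SearchListed = All (λ x → All (λ as →
        Any (λ i → SameCodes (map entryCode as) (row i)) (rowsThrough x)) (searchAt x)) codes

      searchListed? : Dec SearchListed
      searchListed? = all? (λ x → all? (λ as → any? (λ i →
        all? (_∈? row i) (map entryCode as) ×-dec all? (_∈? map entryCode as) (row i))
        (rowsThrough x)) (searchAt x)) codes

      covers : RowsCoverEdges → CoversEdges
      covers rows u v uv =
        let uv-row = All.lookup (All.lookup rows (codeOf-valid u)) (codeOf-valid v) (adj⇒mask uv)
            (i , _ , u∈ , v∈) = find uv-row
        in i , row⇒∈C u∈ , row⇒∈C v∈

      meet : RowsMeetInAtMostOne → MeetInAtMostOneVertex
      meet rows i j i≢j u v ui vi uj vj with All.lookup (All.lookup rows (∈-allFin i)) (∈-allFin j)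
      ... | inj₁ i≡j = ⊥-elim (i≢j i≡j)
      ... | inj₂ small = codeOf-injective (length≤1⇒equal small (common ui uj) (common vi vj))
        where
        common : ∀ {w} → w ∈C copy i → w ∈C copy j → codeOf w ∈ filter (_∈? row j) (row i)
        common wi wj = ∈-filter⁺ (_∈? row j) (∈C⇒row wi) (∈C⇒row wj)

      through : ∀ {m} → RowCount m → ∀ v → HasCard (λ i → v ∈C copy i) m
      through counts v =
        card-resp-⇔ row⇒∈C ∈C⇒row
          (subst (HasCard _) (All.lookup counts (codeOf-valid v))
            (filter-card (λ i → codeOf v ∈? row i) (allFin n) ∈-allFin (Unique.allFin⁺ n)))

      exhaustive : SearchListed → Exhaustive
      exhaustive listed e =
        let e-row = All.lookup (All.lookup listed (codeOf-valid (f e h₀))) (traced-found e)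
            (i , _ , e⊆i , i⊆e) = find e-row
        in i , λ v → (λ { (h , refl) → row⇒∈C (All.lookup e⊆i (traced-codes⁺ e h)) }) ,
                     (λ v∈i → let (h , codeOf-v≡) = traced-codes⁻ e (All.lookup i⊆e (∈C⇒row v∈i))
                              in h , sym (codeOf-injective codeOf-v≡))

      Certified : ℕ → Set
      Certified m = RowsCoverEdges × RowsMeetInAtMostOne × SearchListed × RowCount m

      certified? : ∀ m → Dec (Certified m)
      certified? m = rowsCoverEdges? ×-dec rowsMeetInAtMostOne? ×-dec searchListed? ×-dec rowCount? m

      certified⇒isHGraph : ∀ {m} → Certified m → 1 < m → m < n → Connected G →
        (∀ u → ¬ Adj G u u) → ∀ {h₁} → h₀ ≢ h₁ → IsHGraph G H n m
      certified⇒isHGraph (rows-cover , rows-meet , listed , counts) 1<m m<n connected loopless h₀≢h₁ =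
        isHGraph 1<m m<n connected loopless h₀≢h₁
          (covers rows-cover) (meet rows-meet) (exhaustive listed) (through counts)

      certified⇒containing : ∀ {m} → Certified m → ∀ {h₁} → h₀ ≢ h₁ → ∀ v → CopiesContaining G H v m
      certified⇒containing (_ , rows-meet , listed , counts) h₀≢h₁ v =
        containing (exhaustive listed) (distinct (meet rows-meet) h₀≢h₁) (through counts v)

_≟ᵖ_ : DecidableEquality Pair
_≟ᵖ_ = ≡-dec Fin._≟_ Fin._≟_

_≟ᴰ_ : DecidableEquality PencilData
_≟ᴰ_ = ≡-dec Fin._≟_ (≡-dec _≟ᵖ_ (≡-dec _≟ᵖ_ _≟ᵖ_))

_≟ⱽ_ : DecidableEquality OrdPencil
_≟ⱽ_ = ≡-dec _≟ᴰ_ (λ s t → yes (T-irrelevant s t))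

adj? : Decidable AdjG
adj? ((p , A , B , C) , _) ((p' , A' , B' , C') , _) =
  ¬? (p Fin.≟ p') ×-dec interSize A A' ℕ.≟ 1 ×-dec interSize B B' ℕ.≟ 1 ×-dec interSize C C' ℕ.≟ 1

loopless : ∀ u → ¬ Adj G u u
loopless _ (p≢p , _) = p≢p refl

linePairs : Point → List Pair
linePairs p = filter (λ A → T? (pencilPairᵇ p A)) (cartesianProduct (allFin 7) (allFin 7))

pencilsFrom : Point → Pair → Pair → List PencilData
pencilsFrom p A B = map (λ C → p , A , B , C) (linePairs p)

pencilsAt : Point → List PencilData
pencilsAt p = concatMap (λ A → concatMap (pencilsFrom p A) (linePairs p)) (linePairs p)

candidates : List PencilData
candidates = concatMap pencilsAt (allFin 7)

candidates-complete : ∀ d → T (isOrdPencilᵇ d) → d ∈ candidates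
candidates-complete (p , A , B , C) t =
  let (pA , t') = Equivalence.to (T-∧ {pencilPairᵇ p A}) t
      (pB , t'') = Equivalence.to (T-∧ {pencilPairᵇ p B}) t'
      (pC , _) = Equivalence.to (T-∧ {pencilPairᵇ p C}) t''
  in ∈-concatMap pencilsAt (∈-allFin p)
       (∈-concatMap (λ A → concatMap (pencilsFrom p A) (linePairs p)) (onLine pA)
         (∈-concatMap (pencilsFrom p A) (onLine pB) (∈-map⁺ (λ C → p , A , B , C) (onLine pC))))
  where
  onLine : ∀ {X} → T (pencilPairᵇ p X) → X ∈ linePairs p
  onLine = ∈-filter⁺ (λ A → T? (pencilPairᵇ p A)) (∈-cartesianProduct⁺ (∈-allFin _) (∈-allFin _))

point : ℕ → Point
point k = k mod 7

pencil : (p q r q' r' q'' r'' : ℕ) → PencilData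
pencil p q r q' r' q'' r'' =
  point p , (point q , point r) , (point q' , point r') , (point q'' , point r'')

vertex : (p q r q' r' q'' r'' : ℕ) → {T (isOrdPencilᵇ (pencil p q r q' r' q'' r''))} → OrdPencil
vertex p q r q' r' q'' r'' {t} = pencil p q r q' r' q'' r'' , t

pencilTable : List OrdPencil
pencilTable =
  vertex 0 1 2 3 4 5 6 ∷ vertex 0 1 2 5 6 3 4 ∷ vertex 0 3 4 1 2 5 6 ∷
  vertex 0 3 4 5 6 1 2 ∷ vertex 0 5 6 1 2 3 4 ∷ vertex 0 5 6 3 4 1 2 ∷
  vertex 1 0 2 3 5 4 6 ∷ vertex 1 0 2 4 6 3 5 ∷ vertex 1 3 5 0 2 4 6 ∷
  vertex 1 3 5 4 6 0 2 ∷ vertex 1 4 6 0 2 3 5 ∷ vertex 1 4 6 3 5 0 2 ∷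
  vertex 2 0 1 3 6 4 5 ∷ vertex 2 0 1 4 5 3 6 ∷ vertex 2 3 6 0 1 4 5 ∷
  vertex 2 3 6 4 5 0 1 ∷ vertex 2 4 5 0 1 3 6 ∷ vertex 2 4 5 3 6 0 1 ∷
  vertex 3 0 4 1 5 2 6 ∷ vertex 3 0 4 2 6 1 5 ∷ vertex 3 1 5 0 4 2 6 ∷
  vertex 3 1 5 2 6 0 4 ∷ vertex 3 2 6 0 4 1 5 ∷ vertex 3 2 6 1 5 0 4 ∷
  vertex 4 0 3 1 6 2 5 ∷ vertex 4 0 3 2 5 1 6 ∷ vertex 4 1 6 0 3 2 5 ∷
  vertex 4 1 6 2 5 0 3 ∷ vertex 4 2 5 0 3 1 6 ∷ vertex 4 2 5 1 6 0 3 ∷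
  vertex 5 0 6 1 3 2 4 ∷ vertex 5 0 6 2 4 1 3 ∷ vertex 5 1 3 0 6 2 4 ∷
  vertex 5 1 3 2 4 0 6 ∷ vertex 5 2 4 0 6 1 3 ∷ vertex 5 2 4 1 3 0 6 ∷
  vertex 6 0 5 1 4 2 3 ∷ vertex 6 0 5 2 3 1 4 ∷ vertex 6 1 4 0 5 2 3 ∷
  vertex 6 1 4 2 3 0 5 ∷ vertex 6 2 3 0 5 1 4 ∷ vertex 6 2 3 1 4 0 5 ∷
  []

-- The i-th pencil of the table has code 2^i.
codes : List ℕ
codes = iterate (2 *_) 1 42

decode : {A : Set} → A → List (ℕ × A) → ℕ → A
decode default [] x = default
decode default ((y , a) ∷ table) x = if x ≡ᵇ y then a else decode default table x

vertexAt : ℕ → OrdPencil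
vertexAt = decode (vertex 0 1 2 3 4 5 6) (zip codes pencilTable)

vertices : List OrdPencil
vertices = map vertexAt codes

open DecMembership _≟ᴰ_ using () renaming (_∈?_ to _∈ᴰ?_)

pencils-listed : All (λ d → T (isOrdPencilᵇ d) → d ∈ map proj₁ vertices) candidates
pencils-listed = from-yes (all? (λ d → T? (isOrdPencilᵇ d) →-dec d ∈ᴰ? map proj₁ vertices) candidates)

pencil-≡ : ∀ {d t} (v : OrdPencil) → d ≡ proj₁ v → v ≡ (d , t)
pencil-≡ (_ , t') refl = cong (_ ,_) (T-irrelevant t' _)

vertices-complete : ∀ v → v ∈ vertices
vertices-complete (d , t) =
  let (v , v∈ , d≡v) = ∈-map⁻ proj₁ (All.lookup pencils-listed (candidates-complete d t) t)
  in subst (_∈ vertices) (pencil-≡ v d≡v) v∈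

vertices-unique : Unique vertices
vertices-unique = from-yes (allPairs? (λ u v → ¬? (u ≟ⱽ v)) vertices)

module GFinite = FiniteGraph G vertices vertices-complete vertices-unique _≟ⱽ_ adj?

degrees : All (λ v → length (GFinite.neighbours v) ≡ 12) vertices
degrees = from-yes (all? (λ v → length (GFinite.neighbours v) ℕ.≟ 12) vertices)

all-near : GFinite.AllNear
all-near = from-yes (all? (λ u → all? (GFinite.near? u) vertices) vertices)

-- The pencils (1, 23, 45, 67) and (1, 45, 67, 23) are at distance 3.
u₀ v₀ : OrdPencil
u₀ = vertex 0 1 2 3 4 5 6
v₀ = vertex 0 3 4 5 6 1 2

u₀≢v₀ : u₀ ≢ v₀
u₀≢v₀ = from-yes (¬? (u₀ ≟ⱽ v₀))

¬u₀v₀ : ¬ Adj G u₀ v₀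
¬u₀v₀ = from-yes (¬? (adj? u₀ v₀))

no-path : All (λ w → ¬ (Adj G u₀ w × Adj G w v₀)) vertices
no-path = from-yes (all? (λ w → ¬? (adj? u₀ w ×-dec adj? w v₀)) vertices)

maskTable : List ℕ
maskTable =
  2792069542080 ∷ 1396545958080 ∷ 2791779943680 ∷ 1395915655680 ∷ 210061313280 ∷ 209720609280 ∷
  1272694714371 ∷ 2287628464131 ∷ 1250140700692 ∷ 2281184591912 ∷ 844167200788 ∷ 860277342248 ∷
  692649984195 ∷ 354503884995 ∷ 3304000062740 ∷ 3309452659240 ∷ 395943609620 ∷ 739542305320 ∷
  379081271372 ∷ 706572588172 ∷ 356817904417 ∷ 700750893842 ∷ 3318197830817 ∷ 3334639503442 ∷
  2273112248972 ∷ 1247688827212 ∷ 830007696417 ∷ 835381668882 ∷ 1288495628641 ∷ 2319293022866 ∷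
  206250989680 ∷ 206330963120 ∷ 1374476587786 ∷ 2748950029061 ∷ 1375199757450 ∷ 2749593225285 ∷
  3776258736 ∷ 3525972336 ∷ 21677550602 ∷ 43153759237 ∷ 21789458762 ∷ 43515953797 ∷
  []

mask : ℕ → ℕ
mask = decode 0 (zip codes maskTable)

MaskCorrect : ℕ → ℕ → Set
MaskCorrect x y =
  (T (y ∈ᵇ mask x) → Adj G (vertexAt x) (vertexAt y)) ×
  (Adj G (vertexAt x) (vertexAt y) → T (y ∈ᵇ mask x))

masks-correct : All (λ x → All (MaskCorrect x) codes) codes
masks-correct = from-yes (all? (λ x → all? (λ y →
  (T? (y ∈ᵇ mask x) →-dec adj? (vertexAt x) (vertexAt y)) ×-dec
  (adj? (vertexAt x) (vertexAt y) →-dec T? (y ∈ᵇ mask x))) codes) codes)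

module GCoding = Coding G vertexAt codes mask vertices-complete
  (unique-map⇒injective vertices-unique)
  (λ x∈ y∈ → proj₁ (All.lookup (All.lookup masks-correct x∈) y∈))
  (λ x∈ y∈ → proj₂ (All.lookup (All.lookup masks-correct x∈) y∈))

module K4Pattern =
  GCoding.Pattern K4 zero _ ∈-allFin (Unique.allFin⁺ 4) Fin._≟_ (λ i j → ¬? (i Fin.≟ j))

clique : ℕ → ℕ → ℕ → ℕ → Fin 4 → ℕ
clique a b c d = lookupᵛ (a ∷ b ∷ c ∷ d ∷ [])

cliques : Vec (Fin 4 → ℕ) 42
cliques =
  clique 1 64 268435456 34359738368 ∷ clique 1 128 4194304 2199023255552 ∷
  clique 1 4096 67108864 549755813888 ∷ clique 1 8192 1048576 8589934592 ∷
  clique 2 64 8388608 1099511627776 ∷ clique 2 128 536870912 17179869184 ∷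
  clique 2 4096 2097152 4294967296 ∷ clique 2 8192 134217728 274877906944 ∷
  clique 4 256 33554432 8589934592 ∷ clique 4 1024 524288 549755813888 ∷
  clique 4 16384 16777216 2199023255552 ∷ clique 4 65536 262144 34359738368 ∷
  clique 8 512 16777216 4294967296 ∷ clique 8 2048 262144 274877906944 ∷
  clique 8 32768 33554432 1099511627776 ∷ clique 8 131072 524288 17179869184 ∷
  clique 16 256 2097152 137438953472 ∷ clique 16 1024 134217728 2147483648 ∷
  clique 16 16384 8388608 1073741824 ∷ clique 16 65536 536870912 68719476736 ∷
  clique 32 512 1048576 68719476736 ∷ clique 32 2048 67108864 1073741824 ∷
  clique 32 32768 4194304 2147483648 ∷ clique 32 131072 268435456 137438953472 ∷
  clique 64 4096 1073741824 137438953472 ∷ clique 64 8192 262144 33554432 ∷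
  clique 128 4096 524288 16777216 ∷ clique 128 8192 2147483648 68719476736 ∷
  clique 256 16384 4294967296 1099511627776 ∷ clique 256 65536 1048576 268435456 ∷
  clique 512 32768 8589934592 2199023255552 ∷ clique 512 131072 2097152 536870912 ∷
  clique 1024 16384 4194304 67108864 ∷ clique 1024 65536 17179869184 274877906944 ∷
  clique 2048 32768 8388608 134217728 ∷ clique 2048 131072 34359738368 549755813888 ∷
  clique 262144 16777216 1073741824 68719476736 ∷ clique 524288 33554432 2147483648 137438953472 ∷
  clique 1048576 67108864 4294967296 274877906944 ∷ clique 2097152 134217728 8589934592 549755813888 ∷
  clique 4194304 268435456 17179869184 1099511627776 ∷ clique 8388608 536870912 34359738368 2199023255552 ∷
  []

cliques-valid : All (λ i → K4Pattern.IsCopyCode (lookupᵛ cliques i)) (allFin 42)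
cliques-valid = from-yes (all? (λ i → K4Pattern.isCopyCode? (lookupᵛ cliques i)) (allFin 42))

module K4Table = K4Pattern.Table (lookupᵛ cliques) (λ i → All.lookup cliques-valid (∈-allFin i))

cliques-certified : K4Table.Certified 4
cliques-certified = from-yes (K4Table.certified? 4)

k222-adj? : Decidable (Adj K222)
k222-adj? (a , _) (b , _) = ¬? (a Fin.≟ b)

module K222Pattern = GCoding.Pattern K222 (zero , zero) _
  (λ (a , b) → ∈-cartesianProduct⁺ (∈-allFin a) (∈-allFin b))
  (Unique.cartesianProduct⁺ (Unique.allFin⁺ 3) (Unique.allFin⁺ 2))
  (≡-dec Fin._≟_ Fin._≟_) k222-adj?

octahedron : ℕ → ℕ → ℕ → ℕ → ℕ → ℕ → Fin 3 × Fin 2 → ℕ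
octahedron a a' b b' c c' (i , j) =
  lookupᵛ (lookupᵛ ((a ∷ a' ∷ []) ∷ (b ∷ b' ∷ []) ∷ (c ∷ c' ∷ []) ∷ []) i) j

octahedra : Vec (Fin 3 × Fin 2 → ℕ) 21
octahedra =
  octahedron 1 2 64 128 4096 8192 ∷
  octahedron 1 4 8589934592 34359738368 549755813888 2199023255552 ∷
  octahedron 1 32 1048576 4194304 67108864 268435456 ∷
  octahedron 2 8 4294967296 17179869184 274877906944 1099511627776 ∷
  octahedron 2 16 2097152 8388608 134217728 536870912 ∷
  octahedron 4 8 262144 524288 16777216 33554432 ∷
  octahedron 4 16 256 1024 16384 65536 ∷
  octahedron 8 32 512 2048 32768 131072 ∷
  octahedron 16 32 1073741824 2147483648 68719476736 137438953472 ∷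
  octahedron 64 256 33554432 268435456 137438953472 1099511627776 ∷
  octahedron 64 2048 262144 8388608 1073741824 34359738368 ∷
  octahedron 128 512 16777216 536870912 68719476736 2199023255552 ∷
  octahedron 128 1024 524288 4194304 2147483648 17179869184 ∷
  octahedron 256 512 1048576 2097152 4294967296 8589934592 ∷
  octahedron 1024 2048 67108864 134217728 274877906944 549755813888 ∷
  octahedron 4096 16384 16777216 67108864 1073741824 4294967296 ∷
  octahedron 4096 131072 524288 2097152 137438953472 549755813888 ∷
  octahedron 8192 32768 33554432 134217728 2147483648 8589934592 ∷
  octahedron 8192 65536 262144 1048576 68719476736 274877906944 ∷
  octahedron 16384 32768 4194304 8388608 1099511627776 2199023255552 ∷
  octahedron 65536 131072 268435456 536870912 17179869184 34359738368 ∷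
  []

octahedra-valid : All (λ i → K222Pattern.IsCopyCode (lookupᵛ octahedra i)) (allFin 21)
octahedra-valid = from-yes (all? (λ i → K222Pattern.isCopyCode? (lookupᵛ octahedra i)) (allFin 21))

module K222Table = K222Pattern.Table (lookupᵛ octahedra) (λ i → All.lookup octahedra-valid (∈-allFin i))

octahedra-certified : K222Table.Certified 3
octahedra-certified = from-yes (K222Table.certified? 3)

theorem4p1 : Connected G × IsRegular G 12 × HasOrder G 42 × HasDiameter G 3 ×
             IsHGraph G K4 42 4 × IsHGraph G K222 21 3 ×
             (∀ (v : V G) → CopiesContaining G K222 v 3) ×
             (∀ (v : V G) → CopiesContaining G K4 v 4)
theorem4p1 =
  connected ,
  GFinite.regular degrees ,
  GFinite.order ,
  GFinite.diameter all-near u₀≢v₀ ¬u₀v₀ no-path ,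
  K4Table.certified⇒isHGraph cliques-certified (from-yes (1 ℕ.<? 4)) (from-yes (4 ℕ.<? 42))
    connected loopless K4-second-vertex ,
  K222Table.certified⇒isHGraph octahedra-certified (from-yes (1 ℕ.<? 3)) (from-yes (3 ℕ.<? 21))
    connected loopless K222-second-vertex ,
  K222Table.certified⇒containing octahedra-certified K222-second-vertex ,
  K4Table.certified⇒containing cliques-certified K4-second-vertex
  where
  connected : Connected G
  connected = GFinite.connected all-near
  K4-second-vertex : zero ≢ suc zero
  K4-second-vertex ()
  K222-second-vertex : (zero , zero) ≢ (zero , suc zero)
  K222-second-vertex ()
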